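{- Let $\mathbb{C}$ be a small category equipped with an independent-pullback structure, and let $P\colon\mathbb{C}^{op}\to\mathbf{Set}$ be a presheaf. Then the following are equivalent: (1) $P$ is an atomic sheaf; (2) $P$ maps every independent square to a pullback in $\mathbf{Set}$; that is, for every independent square with legs $f\colon X\to Y$, $g\colon X\to Z$ and cospan $u\colon Y\to W$, $v\colon Z\to W$ (with $u\circ f = v\circ g$), the map $P(W)\to\{(y,z)\in P(Y)\times P(Z)\mid y\cdot f = z\cdot g\}$, $w\mapsto (w\cdot u, w\cdot v)$, is a bijection.
   Context: Presheaf notation: for $f\colon Y\to X$ and $x\in P(X)$, $x\cdot f := P(f)(x)$. For $c\colon Y\to X$, $y\in P(Y)$ is $c$-invariant if $y\cdot d=y\cdot e$ whenever $d,e\colon Z\to Y$ satisfy $c\circ d = c\circ e$; $x\in P(X)$ is a $c$-descendent of $y$ if $y=x\cdot c$. $P$ is an atomic sheaf if for every $c$ every $c$-invariant element has a unique $c$-descendent. A square is a commuting diagram with apex $X$, legs $f\colon X\to Y$, $g\colon X\to Z$ and cospan $u\colon Y\to W$, $v\colon Z\to W$, $u\circ f = v\circ g$. An independent-pullback structure on $\mathbb{C}$ is a class of commuting squares, called independent, such that, calling an independent square an independent pullback if for every independent square with apex $X'$, legs $f'\colon X'\to Y$, $g'\colon X'\to Z$ over the same cospan there is a unique $p\colon X'\to X$ with $f\circ p = f'$, $g\circ p = g'$, the following hold: (IP1) for every $f\colon X\to Y$ the square with apex $X$, legs $\mathrm{id}_X$ and $f$, and cospan $f\colon X\to Y$, $\mathrm{id}_Y$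 is independent; (IP2) a square is independent iff the square obtained by swapping the roles of the two legs (and correspondingly of the two cospan maps) is independent; (IP3) if two independent squares are pasted side by side along a common edge, the composite rectangle (apex the apex of the first square, legs the composite along the top and the remaining leg) is independent; (IP4) if the composite rectangle of two pasted squares is independent and the second (right) square is an independent pullback, then the first (left) square is independent; (IP5) every cospan $Y\to W\leftarrow Z$ completes to an independent pullback. -}

module Defs where

open import Level using (0ℓ)
open import Data.Product using (Σ; Σ-syntax; _×_; _,_)
open import Function.Bundles using (_⇔_)
open import Relation.Binary.PropositionalEquality using (_≡_)

record Category : Set₁ where
  infixr 9 _∘_
  field
    Obj  : Set
    Hom  : Obj → Obj → Set
    id   : ∀ {A} → Hom A A
    _∘_  : ∀ {A B C} → Hom B C → Hom A B → Hom A C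
    identityˡ : ∀ {A B} (f : Hom A B) → id ∘ f ≡ f
    identityʳ : ∀ {A B} (f : Hom A B) → f ∘ id ≡ f
    assoc     : ∀ {A B C D} (h : Hom C D) (g : Hom B C) (f : Hom A B) →
                (h ∘ g) ∘ f ≡ h ∘ (g ∘ f)

-- A presheaf P : C^op → Set.  act x f  is  x · f := P(f)(x).
record Presheaf (𝒞 : Category) : Set₁ where
  open Category 𝒞
  field
    F₀  : Obj → Set
    act : ∀ {X Y} → F₀ X → Hom Y X → F₀ Y
    act-id : ∀ {X} (x : F₀ X) → act x id ≡ x
    act-∘  : ∀ {X Y Z} (x : F₀ X) (f : Hom Y X) (g : Hom Z Y) →
             act x (f ∘ g) ≡ act (act x f) g

module _ {𝒞 : Category} where
  open Category 𝒞

  SquareClass : Set₁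
  SquareClass = ∀ {X Y Z W} → Hom X Y → Hom X Z → Hom Y W → Hom Z W → Set

  IsIndepPullback : SquareClass → ∀ {X Y Z W} →
                    Hom X Y → Hom X Z → Hom Y W → Hom Z W → Set
  IsIndepPullback Indep {X} {Y} {Z} {W} f g u v =
    Indep f g u v ×
    (∀ {X'} (f' : Hom X' Y) (g' : Hom X' Z) → Indep f' g' u v →
       Σ[ p ∈ Hom X' X ] ((f ∘ p ≡ f' × g ∘ p ≡ g') ×
         (∀ (q : Hom X' X) → f ∘ q ≡ f' → g ∘ q ≡ g' → q ≡ p)))

record IndependentPullbackStructure (𝒞 : Category) : Set₁ where
  open Category 𝒞
  field
    Indep : SquareClass {𝒞}
    Indep-comm : ∀ {X Y Z W} {f : Hom X Y} {g : Hom X Z} {u : Hom Y W} {v : Hom Z W} →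
                 Indep f g u v → u ∘ f ≡ v ∘ g
    IP1 : ∀ {X Y} (f : Hom X Y) → Indep id f f id
    IP2 : ∀ {X Y Z W} (f : Hom X Y) (g : Hom X Z) (u : Hom Y W) (v : Hom Z W) →
          Indep f g u v ⇔ Indep g f v u
    IP3 : ∀ {X Y Z W Y' W'} (f : Hom X Y) (g : Hom X Z) (u : Hom Y W) (v : Hom Z W)
            (f' : Hom Y Y') (u' : Hom Y' W') (v' : Hom W W') →
          Indep f g u v → Indep f' u u' v' → Indep (f' ∘ f) g u' (v' ∘ v)
    IP4 : ∀ {X Y Z W Y' W'} (f : Hom X Y) (g : Hom X Z) (u : Hom Y W) (v : Hom Z W)
            (f' : Hom Y Y') (u' : Hom Y' W') (v' : Hom W W') →
          u ∘ f ≡ v ∘ g →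
          Indep (f' ∘ f) g u' (v' ∘ v) → IsIndepPullback {𝒞 = 𝒞} Indep f' u u' v' →
          Indep f g u v
    IP5 : ∀ {Y Z W} (u : Hom Y W) (v : Hom Z W) →
          Σ[ X ∈ Obj ] Σ[ f ∈ Hom X Y ] Σ[ g ∈ Hom X Z ] IsIndepPullback {𝒞 = 𝒞} Indep f g u v

module _ {𝒞 : Category} (P : Presheaf 𝒞) where
  open Category 𝒞
  open Presheaf P

  IsInvariant : ∀ {X Y} (c : Hom Y X) → F₀ Y → Set
  IsInvariant {X} {Y} c y = ∀ {Z} (d e : Hom Z Y) → c ∘ d ≡ c ∘ e → act y d ≡ act y e

  IsDescendent : ∀ {X Y} (c : Hom Y X) → F₀ Y → F₀ X → Set
  IsDescendent c y x = y ≡ act x c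

  IsAtomicSheaf : Set
  IsAtomicSheaf = ∀ {X Y} (c : Hom Y X) (y : F₀ Y) → IsInvariant c y →
    Σ[ x ∈ F₀ X ] (IsDescendent c y x × (∀ x' → IsDescendent c y x' → x' ≡ x))

  SendsToPullback : ∀ {X Y Z W} → Hom X Y → Hom X Z → Hom Y W → Hom Z W → Set
  SendsToPullback {X} {Y} {Z} {W} f g u v =
    (∀ (w w' : F₀ W) → act w u ≡ act w' u → act w v ≡ act w' v → w ≡ w') ×
    (∀ (y : F₀ Y) (z : F₀ Z) → act y f ≡ act z g →
       Σ[ w ∈ F₀ W ] (act w u ≡ y × act w v ≡ z))

  MapsIndependentToPullbacks : IndependentPullbackStructure 𝒞 → Set
  MapsIndependentToPullbacks S =
    ∀ {X Y Z W} (f : Hom X Y) (g : Hom X Z) (u : Hom Y W) (v : Hom Z W) →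
      IndependentPullbackStructure.Indep S f g u v → SendsToPullback f g u v

module Submission where

-- An atomic sheaf sends every arrow to an injection, since x · c is always a c-invariant
-- element with unique descendent x. Given an independent square (f, g, u, v) and a
-- compatible pair y · f = z · g, it therefore suffices to show that y is u-invariant: its
-- u-descendent w then satisfies w · v · g = w · u · f = z · g, hence w · v = z. For
-- invariance, take d, e : T → Y with u ∘ d = u ∘ e and an independent pullback N of v and
-- u ∘ e; pasting an independent pullback of h and f onto the square and factoring through N
-- shows y · h agrees with z on N for both h = d and h = e, and restriction to N is injective.
-- Conversely, if P sends independent squares to pullbacks, a c-invariant y is a compatible
-- pair on the independent kernel pair of c, and the pullback property of P there is exactly
-- existence and uniqueness of its c-descendent.

open import Defs
open import Function.Bundles using (_⇔_; mk⇔; Equivalence)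
open import Data.Product using (Σ-syntax; _×_; _,_)
open import Relation.Binary.PropositionalEquality using (_≡_; refl; sym; trans; cong; subst; module ≡-Reasoning)

module _ {𝒞 : Category} (P : Presheaf 𝒞) where
  open Category 𝒞
  open Presheaf P

  act-square : ∀ {X Y Y' Z} (x : F₀ X) {f : Hom Y X} {g : Hom Z Y} {f' : Hom Y' X} {g' : Hom Z Y'} →
               f ∘ g ≡ f' ∘ g' → act (act x f) g ≡ act (act x f') g'
  act-square x {f} {g} {f'} {g'} eq = trans (sym (act-∘ x f g)) (trans (cong (act x) eq) (act-∘ x f' g'))

  restriction-isInvariant : ∀ {X Y} (c : Hom Y X) (x : F₀ X) → IsInvariant P c (act x c)
  restriction-isInvariant c x d e = act-square x

  atomic⇒act-injective : IsAtomicSheaf P → ∀ {X Y} (c : Hom Y X) {x x' : F₀ X} →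
                         act x c ≡ act x' c → x ≡ x'
  atomic⇒act-injective sheaf c {x} {x'} eq
    with sheaf c (act x c) (restriction-isInvariant c x)
  ... | _ , _ , unique = trans (unique x refl) (sym (unique x' eq))

module _ {𝒞 : Category} (S : IndependentPullbackStructure 𝒞) where
  open Category 𝒞
  open IndependentPullbackStructure S

  Indep-paste-transposed : ∀ {R T X Y Z W} {a : Hom R T} {b : Hom R X} {h : Hom T Y}
                             {f : Hom X Y} {g : Hom X Z} {u : Hom Y W} {v : Hom Z W} →
                           Indep a b h f → Indep f g u v → Indep (g ∘ b) a v (u ∘ h)
  Indep-paste-transposed {a = a} {b} {h} {f} {g} {u} {v} indR ind =
    IP3 b a f h g v u (Equivalence.to (IP2 a b h f) indR) (Equivalence.to (IP2 f g u v) ind)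

  module _ (P : Presheaf 𝒞) (sheaf : IsAtomicSheaf P) where
    open Presheaf P

    compatible-restrict-to-pullback :
      ∀ {X Y Z W T N} {f : Hom X Y} {g : Hom X Z} {u : Hom Y W} {v : Hom Z W} →
      Indep f g u v → {y : F₀ Y} {z : F₀ Z} → act y f ≡ act z g →
      (h : Hom T Y) {k : Hom T W} → u ∘ h ≡ k →
      {n₁ : Hom N Z} {n₂ : Hom N T} → IsIndepPullback {𝒞 = 𝒞} Indep n₁ n₂ v k →
      act (act y h) n₂ ≡ act z n₁
    compatible-restrict-to-pullback {f = f} {g} ind {y} {z} compat h uh≡k {n₁} {n₂} (_ , factor)
      with IP5 h f
    ... | _ , a , b , indR , _
      with factor (g ∘ b) a (subst (Indep (g ∘ b) a _) uh≡k (Indep-paste-transposed indR ind))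
    ... | ρ , (n₁ρ≡gb , n₂ρ≡a) , _ = atomic⇒act-injective P sheaf ρ (begin
      act (act (act y h) n₂) ρ  ≡⟨ sym (act-∘ (act y h) n₂ ρ) ⟩
      act (act y h) (n₂ ∘ ρ)    ≡⟨ cong (act (act y h)) n₂ρ≡a ⟩
      act (act y h) a           ≡⟨ act-square P y (Indep-comm indR) ⟩
      act (act y f) b           ≡⟨ cong (λ t → act t b) compat ⟩
      act (act z g) b           ≡⟨ act-square P z (sym n₁ρ≡gb) ⟩
      act (act z n₁) ρ          ∎)
      where open ≡-Reasoning

    compatible⇒isInvariant : ∀ {X Y Z W} {f : Hom X Y} {g : Hom X Z} {u : Hom Y W} {v : Hom Z W} →
                             Indep f g u v → {y : F₀ Y} {z : F₀ Z} → act y f ≡ act z g →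
                             IsInvariant P u y
    compatible⇒isInvariant {u = u} {v} ind compat d e ud≡ue with IP5 v (u ∘ e)
    ... | _ , _ , n₂ , pullback = atomic⇒act-injective P sheaf n₂
      (trans (compatible-restrict-to-pullback ind compat d ud≡ue pullback)
             (sym (compatible-restrict-to-pullback ind compat e refl pullback)))

    atomic⇒mapsIndependentToPullbacks : MapsIndependentToPullbacks P S
    atomic⇒mapsIndependentToPullbacks f g u v ind =
      (λ w w' wu≡w'u _ → atomic⇒act-injective P sheaf u wu≡w'u) , glue
      where
        glue : ∀ y z → act y f ≡ act z g → Σ[ w ∈ F₀ _ ] (act w u ≡ y × act w v ≡ z)
        glue y z compat with sheaf u y (compatible⇒isInvariant ind compat)
        ... | w , y≡wu , _ = w , sym y≡wu , atomic⇒act-injective P sheaf g (begin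
          act (act w v) g  ≡⟨ act-square P w (sym (Indep-comm ind)) ⟩
          act (act w u) f  ≡⟨ cong (λ t → act t f) (sym y≡wu) ⟩
          act y f          ≡⟨ compat ⟩
          act z g          ∎)
          where open ≡-Reasoning

  mapsIndependentToPullbacks⇒atomic : (P : Presheaf 𝒞) → MapsIndependentToPullbacks P S → IsAtomicSheaf P
  mapsIndependentToPullbacks⇒atomic P preserves c y invariant with IP5 c c
  ... | _ , p₁ , p₂ , indK , _ with preserves p₁ p₂ c c indK
  ... | injective , surjective with surjective y y (invariant p₁ p₂ (Indep-comm indK))
  ... | w , wc≡y , _ = w , sym wc≡y , λ x y≡xc →
    let xc≡wc = trans (sym y≡xc) (sym wc≡y) in injective x w xc≡wc xc≡wc

theorem6p4 : (𝒞 : Category) (S : IndependentPullbackStructure 𝒞) (P : Presheaf 𝒞) →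
    IsAtomicSheaf P ⇔ MapsIndependentToPullbacks P S
theorem6p4 𝒞 S P =
  mk⇔ (atomic⇒mapsIndependentToPullbacks S P) (mapsIndependentToPullbacks⇒atomic S P)
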